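{- Let $p_1=2<p_2=3<\cdots$ be the sequence of consecutive primes. Suppose that $\sqrt{p_{n+1}}-\sqrt{p_n}<1$ holds for all $n$. Then every prime power $q$ is a member of some Hasse pair, and every odd prime power is a member of some odd Hasse pair.
   Context: A pair $(q_1,q_2)$ of distinct prime powers is a Hasse pair if $|\sqrt{q_1}-\sqrt{q_2}|\le 1$; it is an odd Hasse pair if moreover both $q_1$ and $q_2$ are odd. -}

module Defs where

open import Data.Nat using (ℕ; _+_; _*_; _∸_; _^_; _≤_; _<_)
open import Data.Nat.Primality using (Prime)
open import Data.Nat.Divisibility using (_∣_)
open import Data.Product using (Σ; ∃; _×_)
open import Relation.Nullary using (¬_)
open import Relation.Binary.PropositionalEquality using (_≡_; _≢_)

ConsecutivePrimes : ℕ → ℕ → Set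
ConsecutivePrimes p p' =
  Prime p × Prime p' × p < p' × (∀ r → p < r → r < p' → ¬ Prime r)

-- √b − √a < 1  (for naturals a ≥ 1), squared-out:
-- √b < √a + 1  ⇔  b − a − 1 < 2√a  ⇔  (b ∸ a ∸ 1)² < 4a.
SqrtGapLt1 : ℕ → ℕ → Set
SqrtGapLt1 a b = (b ∸ a ∸ 1) ^ 2 < 4 * a

-- |√a − √b| ≤ 1, squared-out in both directions:
-- √b − √a ≤ 1 ⇔ (b ∸ a ∸ 1)² ≤ 4a, and symmetrically.
SqrtDistLe1 : ℕ → ℕ → Set
SqrtDistLe1 a b = ((b ∸ a ∸ 1) ^ 2 ≤ 4 * a) × ((a ∸ b ∸ 1) ^ 2 ≤ 4 * b)

PrimePower : ℕ → Set
PrimePower q = Σ ℕ λ p → Σ ℕ λ k → Prime p × 1 ≤ k × q ≡ p ^ k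

Odd : ℕ → Set
Odd n = ¬ (2 ∣ n)

HassePair : ℕ → ℕ → Set
HassePair q₁ q₂ = PrimePower q₁ × PrimePower q₂ × q₁ ≢ q₂ × SqrtDistLe1 q₁ q₂

OddHassePair : ℕ → ℕ → Set
OddHassePair q₁ q₂ = HassePair q₁ q₂ × Odd q₁ × Odd q₂

{-# OPTIONS --safe #-}
-- For q above a prime a, walking up the consecutive primes from a yields
-- consecutive primes r < q ≤ s with a ≤ r. If q = s, the hypothesis makes (r, q)
-- a Hasse pair; otherwise √s − √q ≤ √s − √r < 1 makes (q, s) one. Taking a = 3
-- the partner is an odd prime; q = 2 and q = 3 are covered by (2, 3) and (3, 5).
module Submission where

open import Defs
open import Data.Nat using (ℕ)
open import Data.Product using (_×_; ∃; _,_)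
open import Data.Sum using (_⊎_; inj₁; inj₂)
open import Data.Nat.Base using (suc; _*_; _∸_; _^_; _≤_; _<_; z≤n; s≤s; _!; nonTrivial⇒n>1)
open import Data.Nat.Properties
open import Data.Nat.Divisibility using (_∣_; ∣-refl; ∣-trans; ∣⇒≤; m∣m*n; ∣m+n∣m⇒∣n; m≤n⇒m!∣n!)
open import Data.Nat.Divisibility.Core using (hasNonTrivialDivisor)
open import Data.Nat.ListAction using (product)
open import Data.Nat.Primality
  using (Prime; prime?; prime[2]; prime⇒nonTrivial; prime⇒¬composite)
open import Data.Nat.Primality.Factorisation using (factorise)
open import Data.List using ([]; _∷_)
open import Data.List.Relation.Unary.All using (_∷_)
open import Data.Empty using (⊥-elim)
open import Data.Nat.Induction using (<-wellFounded)
open import Induction.WellFounded using (Acc; acc)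
open import Relation.Nullary using (¬_; yes; no)
open import Relation.Nullary.Decidable using (from-yes; _×-dec_)
open import Relation.Unary using (Decidable)
open import Relation.Binary.PropositionalEquality using (refl; sym; subst)

prime⇒1<p : ∀ {p} → Prime p → 1 < p
prime⇒1<p {p} pp = nonTrivial⇒n>1 p {{prime⇒nonTrivial pp}}

prime[3] : Prime 3
prime[3] = from-yes (prime? 3)

prime[5] : Prime 5
prime[5] = from-yes (prime? 5)

prime⇒odd : ∀ {p} → Prime p → 3 ≤ p → Odd p
prime⇒odd pp 3≤p 2∣p = prime⇒¬composite pp (hasNonTrivialDivisor 3≤p 2∣p)

∃prime∣ : ∀ {n} → 2 ≤ n → ∃ λ p → Prime p × p ∣ n
∃prime∣ {n} (s≤s (s≤s _)) with factorise n
... | record { factors = [] ; isFactorisation = () }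
... | record { factors = p ∷ ps ; isFactorisation = n≡p*ps ; factorsPrime = pp ∷ _ } =
  p , pp , subst (p ∣_) (sym n≡p*ps) (m∣m*n (product ps))

n∣m! : ∀ {m n} → 1 ≤ n → n ≤ m → n ∣ m !
n∣m! {n = suc n} _ n≤m = ∣-trans (m∣m*n (n !)) (m≤n⇒m!∣n! n≤m)

∃prime> : ∀ n → ∃ λ p → Prime p × n < p
∃prime> n with ∃prime∣ (+-monoˡ-≤ 1 (1≤n! n))
... | p , pp , p∣n!+1 with n <? p
...   | yes n<p = p , pp , n<p
...   | no n≮p = ⊥-elim (<⇒≱ (prime⇒1<p pp) (∣⇒≤ p∣1))
  where
  p∣1 : p ∣ 1
  p∣1 = ∣m+n∣m⇒∣n p∣n!+1 (n∣m! (<⇒≤ (prime⇒1<p pp)) (≮⇒≥ n≮p))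

Least : ∀ {ℓ} → (ℕ → Set ℓ) → ℕ → Set ℓ
Least P m = P m × (∀ k → k < m → ¬ P k)

module _ {ℓ} {P : ℕ → Set ℓ} (P? : Decidable P) where

  least-or-none : ∀ n → (∃ λ m → Least P m) ⊎ (∀ k → k < n → ¬ P k)
  least-or-none 0 = inj₂ λ _ ()
  least-or-none (suc n) with least-or-none n | P? n
  ... | inj₁ least | _      = inj₁ least
  ... | inj₂ none  | yes pn = inj₁ (n , pn , none)
  ... | inj₂ none  | no ¬pn = inj₂ none≤n
    where
    none≤n : ∀ k → k < suc n → ¬ P k
    none≤n k k<1+n with m<1+n⇒m<n∨m≡n k<1+n
    ... | inj₁ k<n  = none k k<n
    ... | inj₂ refl = ¬pn

  ∃⇒∃-least : ∀ {n} → P n → ∃ λ m → Least P m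
  ∃⇒∃-least {n} pn with least-or-none (suc n)
  ... | inj₁ least = least
  ... | inj₂ none  = ⊥-elim (none n (n<1+n n) pn)

∃consecutivePrime : ∀ {r} → Prime r → ∃ λ s → ConsecutivePrimes r s
∃consecutivePrime {r} pr with ∃prime> r
... | b , pb , r<b with ∃⇒∃-least (λ k → r <? k ×-dec prime? k) (r<b , pb)
...   | s , (r<s , ps) , below = s , pr , ps , r<s , λ t r<t t<s pt → below t t<s (r<t , pt)

StraddlingPrimes : ℕ → ℕ → Set
StraddlingPrimes a q = ∃ λ r → ∃ λ s → ConsecutivePrimes r s × a ≤ r × r < q × q ≤ s

straddlingPrimes-anti : ∀ {a b q} → a ≤ b → StraddlingPrimes b q → StraddlingPrimes a q
straddlingPrimes-anti a≤b (r , s , c , b≤r , r<q , q≤s) = r , s , c , ≤-trans a≤b b≤r , r<q , q≤s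

straddlingPrimes : ∀ {a q} → Prime a → a < q → StraddlingPrimes a q
straddlingPrimes = walk (<-wellFounded _)
  where
  walk : ∀ {a q} → Acc _<_ (q ∸ a) → Prime a → a < q → StraddlingPrimes a q
  walk {a} {q} (acc rec) pa a<q with ∃consecutivePrime pa
  ... | s , c@(_ , ps , a<s , _) with q ≤? s
  ...   | yes q≤s = a , s , c , ≤-refl , a<q , q≤s
  ...   | no q≰s  = straddlingPrimes-anti (<⇒≤ a<s) (walk (rec (∸-monoʳ-< a<s (<⇒≤ s<q))) ps s<q)
    where
    s<q : s < q
    s<q = ≰⇒> q≰s

primePower⇒1< : ∀ {q} → PrimePower q → 1 < q
primePower⇒1< (p , k , pp , 1≤k , refl) = ^-monoʳ-< p (prime⇒1<p pp) 1≤k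

prime⇒primePower : ∀ {p} → Prime p → PrimePower p
prime⇒primePower {p} pp = p , 1 , pp , ≤-refl , sym (*-identityʳ p)

oddPrimePower⇒2< : ∀ {q} → PrimePower q → Odd q → 2 < q
oddPrimePower⇒2< ppq oq with m≤n⇒m<n∨m≡n (primePower⇒1< ppq)
... | inj₁ 2<q  = 2<q
... | inj₂ refl = ⊥-elim (oq ∣-refl)

sqrtGapLt1-shrinkˡ : ∀ {a b c} → a ≤ b → SqrtGapLt1 a c → SqrtGapLt1 b c
sqrtGapLt1-shrinkˡ {a} {b} {c} a≤b gap = begin-strict
  (c ∸ b ∸ 1) ^ 2 ≤⟨ ^-monoˡ-≤ 2 (∸-monoˡ-≤ 1 (∸-monoʳ-≤ c a≤b)) ⟩
  (c ∸ a ∸ 1) ^ 2 <⟨ gap ⟩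
  4 * a           ≤⟨ *-monoʳ-≤ 4 a≤b ⟩
  4 * b           ∎
  where open ≤-Reasoning

sqrtGapLt1⇒sqrtDistLe1 : ∀ {a b} → a ≤ b → SqrtGapLt1 a b → SqrtDistLe1 a b
sqrtGapLt1⇒sqrtDistLe1 a≤b gap rewrite m≤n⇒m∸n≡0 a≤b = <⇒≤ gap , z≤n

hassePair-in-gap : ∀ {r s q} → Prime r → Prime s → SqrtGapLt1 r s → PrimePower q →
                   r < q → q ≤ s → HassePair q s ⊎ HassePair r q
hassePair-in-gap pr ps gap ppq r<q q≤s with m≤n⇒m<n∨m≡n q≤s
... | inj₁ q<s  = inj₁ (ppq , prime⇒primePower ps , <⇒≢ q<s ,
                        sqrtGapLt1⇒sqrtDistLe1 (<⇒≤ q<s) (sqrtGapLt1-shrinkˡ (<⇒≤ r<q) gap))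
... | inj₂ refl = inj₂ (prime⇒primePower pr , ppq , <⇒≢ r<q , sqrtGapLt1⇒sqrtDistLe1 (<⇒≤ r<q) gap)

PrimeSqrtGapsLt1 : Set
PrimeSqrtGapsLt1 = ∀ p p' → ConsecutivePrimes p p' → SqrtGapLt1 p p'

primeHassePartner : PrimeSqrtGapsLt1 → ∀ {a q} → Prime a → a < q → PrimePower q →
                    ∃ λ p → Prime p × a ≤ p × (HassePair q p ⊎ HassePair p q)
primeHassePartner gaps pa a<q ppq with straddlingPrimes pa a<q
... | r , s , c@(pr , ps , r<s , _) , a≤r , r<q , q≤s with hassePair-in-gap pr ps (gaps r s c) ppq r<q q≤s
...   | inj₁ qs = s , ps , ≤-trans a≤r (<⇒≤ r<s) , inj₁ qs
...   | inj₂ rq = r , pr , a≤r , inj₂ rq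

hassePair[2,3] : HassePair 2 3
hassePair[2,3] = prime⇒primePower prime[2] , prime⇒primePower prime[3] , (λ ()) , z≤n , z≤n

oddHassePair[3,5] : OddHassePair 3 5
oddHassePair[3,5] =
  (prime⇒primePower prime[3] , prime⇒primePower prime[5] , (λ ()) , s≤s z≤n , z≤n) ,
  prime⇒odd prime[3] ≤-refl , prime⇒odd prime[5] (s≤s (s≤s (s≤s z≤n)))

propositionA4 :
    (∀ p p' → ConsecutivePrimes p p' → SqrtGapLt1 p p') →
    (∀ q → PrimePower q → ∃ λ q' → HassePair q q' ⊎ HassePair q' q)
    × (∀ q → PrimePower q → Odd q → ∃ λ q' → OddHassePair q q' ⊎ OddHassePair q' q)
propositionA4 gaps = hassePartner , oddHassePartner
  where
  hassePartner : ∀ q → PrimePower q → ∃ λ q' → HassePair q q' ⊎ HassePair q' q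
  hassePartner q ppq with m≤n⇒m<n∨m≡n (primePower⇒1< ppq)
  ... | inj₂ refl = 3 , inj₁ hassePair[2,3]
  ... | inj₁ 2<q with primeHassePartner gaps prime[2] 2<q ppq
  ...   | p , _ , _ , pair = p , pair

  oddHassePartner : ∀ q → PrimePower q → Odd q → ∃ λ q' → OddHassePair q q' ⊎ OddHassePair q' q
  oddHassePartner q ppq oq with m≤n⇒m<n∨m≡n (oddPrimePower⇒2< ppq oq)
  ... | inj₂ refl = 5 , inj₁ oddHassePair[3,5]
  ... | inj₁ 3<q with primeHassePartner gaps prime[3] 3<q ppq
  ...   | p , pp , 3≤p , inj₁ qp = p , inj₁ (qp , oq , prime⇒odd pp 3≤p)
  ...   | p , pp , 3≤p , inj₂ pq = p , inj₂ (pq , prime⇒odd pp 3≤p , oq)
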